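{- Let $t$ be a binary tree whose nodes are partitioned into micro trees by the Farzan–Munro algorithm, and let $\mu$ be a micro tree that has at least one child micro tree. Then the split rank of $\mu$ equals the portal rank of the leftmost child micro tree of $\mu$ (the child micro tree of $\mu$ with the smallest portal rank).
   Context: A binary tree is a rooted tree where each node has a left and a right child slot, each possibly empty. $\mathrm{BP}_\mathrm{b}(t)=\epsilon$ if $t$ is empty and otherwise $\texttt{(}\cdot \mathrm{BP}_\mathrm{b}(t_l)\cdot \texttt{)}\cdot \mathrm{BP}_\mathrm{b}(t_r)$, with $t_l,t_r$ the left and right subtrees of the root; node $v$ corresponds to the matching pair inserted when expanding the subtree rooted at $v$. The Farzan–Munro algorithm partitions the nodes of a binary tree into disjoint micro trees, each a connected set of nodes rooted at its topmost node; it is known that contracting each micro tree into a single node yields a binary tree and that any micro tree with two child micro trees consists of a single node. A child micro tree of $\mu$ is a micro tree $\nu$ whose root $c$ has its parent $p$ in $\mu$. Chunks of $\mu$: the positions in $\mathrm{BP}_\mathrm{b}(t)$ of the parentheses of nodes of $\mu$ form one or two maximal intervals; if two, the left chunk is the left one and the right chunk the right one; if one, the left chunk is that interval and the right chunk is empty. The split rank of $\mu$ is the number of closing parentheses in its left chunk plus one. Portal rank: for a child micro tree $\nu$ of $\mu$ with root $c$ attached (as left or right child) to $p\in\mu$, consider the binary tree $\mu\cup\{c\}$ (the micro tree $\mu$ with $c$ added as a leaf in that slot); the portal rank of $\nu$ is the inorder rank (starting at $1$) of $c$ in $\mu\cup\{c\}$. -}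

module Defs where

open import Data.Nat using (ℕ; zero; suc; _≟_; _≡ᵇ_)
open import Data.Bool using (Bool; true; false; if_then_else_; _∨_)
open import Data.List using (List; []; _∷_; _++_; [_]; map; length; filter; takeWhile; dropWhile)
open import Data.List.Properties using (≡-dec)
open import Data.Product using (_×_; _,_; proj₁; proj₂; ∃; ∃-syntax)
open import Relation.Binary.PropositionalEquality using (_≡_; _≢_; refl)
open import Relation.Nullary using (Dec; yes; no; ¬?)
open import Relation.Nullary.Decidable using (⌊_⌋)
open import Relation.Unary using (Pred)
open import Data.Sum using (_⊎_)

data Tree : Set where
  leaf : Tree
  node : Tree → Tree → Tree

-- A node is addressed by its path from the root (first step first).
data Dir : Set where
  L R : Dir

_≟D_ : (a b : Dir) → Dec (a ≡ b)
L ≟D L = yes refl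
L ≟D R = no λ ()
R ≟D L = no λ ()
R ≟D R = yes refl

Path : Set
Path = List Dir

_==P_ : Path → Path → Bool
p ==P q = ⌊ ≡-dec _≟D_ p q ⌋

data IsNode : Tree → Path → Set where
  here : ∀ {l r} → IsNode (node l r) []
  goL  : ∀ {l r p} → IsNode l p → IsNode (node l r) (L ∷ p)
  goR  : ∀ {l r p} → IsNode r p → IsNode (node l r) (R ∷ p)

-- subtree of t rooted at path p (leaf if p is not a node)
subtree : Tree → Path → Tree
subtree t [] = t
subtree leaf (_ ∷ _) = leaf
subtree (node l r) (L ∷ p) = subtree l p
subtree (node l r) (R ∷ p) = subtree r p

_≼_ : Path → Path → Set
p ≼ q = ∃[ s ] p ++ s ≡ q

-- A set of nodes is connected: every node on the tree path between two members
-- (i.e. every x that is an ancestor of u and a descendant of lca(u,w)) is a member.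
Connected : (Path → Set) → Set
Connected S = ∀ u w x → S u → S w → x ≼ u → (∀ y → y ≼ u → y ≼ w → y ≼ x) → S x

-- Partition of the nodes of t into micro trees, given by a labelling
-- m : Path → ℕ; micro tree k = the nodes with label k.

InMicro : Tree → (Path → ℕ) → ℕ → Path → Set
InMicro t m k x = IsNode t x × m x ≡ k

IsRootOf : Tree → (Path → ℕ) → ℕ → Path → Set
IsRootOf t m k c = InMicro t m k c × (∀ p d → c ≡ p ++ [ d ] → m p ≢ k)

IsChildRoot : Tree → (Path → ℕ) → ℕ → Path → Set
IsChildRoot t m k c =
  (∃[ j ] IsRootOf t m j c) × (∃[ p ] ∃[ d ] (c ≡ p ++ [ d ] × InMicro t m k p))

-- The known structural properties of a Farzan–Munro partition:
--  * each micro tree is connected;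
--  * contracting micro trees yields a binary tree (each micro tree has at most two child micro trees);
--  * a micro tree with two (distinct) child micro trees consists of a single node.
record FMPartition (t : Tree) (m : Path → ℕ) : Set where
  field
    connected : ∀ k → Connected (InMicro t m k)
    atMostTwoChildren : ∀ k c₁ c₂ c₃ → IsChildRoot t m k c₁ → IsChildRoot t m k c₂ → IsChildRoot t m k c₃
                        → (c₁ ≡ c₂) ⊎ ((c₁ ≡ c₃) ⊎ (c₂ ≡ c₃))
    twoChildrenSingle : ∀ k c₁ c₂ → IsChildRoot t m k c₁ → IsChildRoot t m k c₂ → c₁ ≢ c₂
                        → ∀ x y → InMicro t m k x → InMicro t m k y → x ≡ y

-- Balanced parentheses BP_b(t), each parenthesis tagged with the node (path) it belongs to:
-- BP_b(empty) = ε,  BP_b(t) = ( · BP_b(t_l) · ) · BP_b(t_r)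

data Paren : Set where
  op cl : Paren

isClose : Paren → Bool
isClose op = false
isClose cl = true

tag : Dir → Paren × Path → Paren × Path
tag d (x , p) = (x , d ∷ p)

bp : Tree → List (Paren × Path)
bp leaf = []
bp (node l r) = (op , []) ∷ map (tag L) (bp l) ++ (cl , []) ∷ map (tag R) (bp r)

-- The left chunk of micro tree k: the first maximal interval of positions of BP_b(t)
-- holding parentheses of nodes of k.
leftChunk : Tree → (Path → ℕ) → ℕ → List (Paren × Path)
leftChunk t m k =
  takeWhile (λ e → m (proj₂ e) ≟ k) (dropWhile (λ e → ¬? (m (proj₂ e) ≟ k)) (bp t))

splitRank : Tree → (Path → ℕ) → ℕ → ℕ
splitRank t m k = suc (length (filter (λ e → isClose (proj₁ e) Data.Bool.≟ true) (leftChunk t m k)))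
  where import Data.Bool

-- Inorder traversal of the binary tree induced by the node set S (given as a Boolean
-- predicate) hanging from the node at path p, where s is the subtree of t at p;
-- nodes are named by their absolute paths in t.
inorderInduced : (Path → Bool) → Path → Tree → List Path
inorderInduced S p leaf = []
inorderInduced S p (node l r) =
  if S p then inorderInduced S (p ++ [ L ]) l ++ [ p ] ++ inorderInduced S (p ++ [ R ]) r
  else []

indexOf : Path → List Path → ℕ
indexOf x [] = zero
indexOf x (y ∷ ys) = if x ==P y then zero else suc (indexOf x ys)

-- portal rank of the child micro tree with root c of micro tree k whose root is r:
-- inorder rank (from 1) of c in the binary tree μ ∪ {c}.
portalRank : Tree → (Path → ℕ) → ℕ → (r c : Path) → ℕ
portalRank t m k r c =
  suc (indexOf c (inorderInduced (λ x → (m x ≡ᵇ k) ∨ (x ==P c)) r (subtree t r)))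

{-# OPTIONS --safe #-}
-- Every parenthesis of BP_b(t) before the opening one of the root r of μ belongs to a node that is
-- not a descendant of r, hence not in μ; so the left chunk starts with the opening parenthesis of r.
-- Follow the path from r to the leftmost child root c. A step to the left passes neither a closing
-- parenthesis nor an inorder predecessor of c. A step to the right from q passes the left subtree
-- of q and q itself, contributing equally to both counts, because that left subtree lies entirely
-- in μ: a child root inside it would have smaller portal rank than c. At c the left chunk ends,
-- and c comes first in the inorder traversal of μ ∪ {c} restricted to its subtree.
module Submission where

open import Defs
open import Data.Nat using (ℕ; _≤_; _<_; suc; _+_; _≟_; _≡ᵇ_; z≤n; s≤s)
open import Data.Nat.Properties using (+-suc; ≤-trans; ≤-reflexive; <⇒≱)
open import Data.Bool using (Bool; true; false; _∨_)
import Data.Bool as Bool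
open import Data.Bool.Properties using (∨-zeroʳ)
open import Data.List using (List; []; _∷_; _++_; [_]; map; length; filter; takeWhile; dropWhile)
open import Data.List.Properties using (++-assoc; ++-identityʳ; ++-cancelˡ; map-++; length-++; filter-++; ∷-injectiveˡ; ∷ʳ-injectiveˡ; ≡-dec)
open import Data.List.Relation.Unary.All as All using (All; []; _∷_)
open import Data.List.Relation.Unary.All.Properties using (++⁺)
open import Data.Product using (_×_; _,_; proj₁; proj₂; ∃-syntax; ∃₂)
open import Data.Sum using (_⊎_; inj₁; inj₂)
open import Data.Empty using (⊥-elim)
open import Function using (_∘_)
open import Relation.Binary.PropositionalEquality using (_≡_; _≢_; refl; sym; trans; cong; cong₂; subst; module ≡-Reasoning)
open import Relation.Nullary using (¬_; yes; no; ¬?)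
open import Relation.Nullary.Decidable using (dec-true; dec-false; isYes≗does)
open import Relation.Unary using (Pred; Decidable)

open ≡-Reasoning

≼-refl : ∀ {x} → x ≼ x
≼-refl {x} = [] , ++-identityʳ x

≼-trans : ∀ {x y z} → x ≼ y → y ≼ z → x ≼ z
≼-trans {x} (s , refl) (s′ , refl) = s ++ s′ , sym (++-assoc x s s′)

≼-∷ : ∀ {d x y} → x ≼ y → (d ∷ x) ≼ (d ∷ y)
≼-∷ {d} (s , e) = s , cong (d ∷_) e

xs++y∷ys≢xs : ∀ (q : Path) {d w} → q ++ d ∷ w ≢ q
xs++y∷ys≢xs q {d} {w} e with () ← ++-cancelˡ q (d ∷ w) [] (trans e (sym (++-identityʳ q)))

≼-child⇒≢ : ∀ {q d x} → (q ++ [ d ]) ≼ x → x ≢ q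
≼-child⇒≢ {q} {d} (w , e) x≡q = xs++y∷ys≢xs q (trans (sym (++-assoc q [ d ] w)) (trans e x≡q))

≼-left⇒¬≼-right : ∀ {q x} → (q ++ [ L ]) ≼ x → ¬ ((q ++ [ R ]) ≼ x)
≼-left⇒¬≼-right {q} (a , refl) (b , e)
  with () ← ∷-injectiveˡ (++-cancelˡ q (R ∷ b) (L ∷ a)
              (trans (sym (++-assoc q [ R ] b)) (trans e (++-assoc q [ L ] a))))

parent-of-descendant : ∀ q d w → ∃₂ λ p e → q ++ d ∷ w ≡ p ++ [ e ] × q ≼ p
parent-of-descendant q d [] = q , d , refl , ≼-refl
parent-of-descendant q d (x ∷ w) =
  let p , e , eq , qd≼p = parent-of-descendant (q ++ [ d ]) x w in
  p , e , trans (sym (++-assoc q [ d ] (x ∷ w))) eq , ≼-trans ([ d ] , refl) qd≼p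

commonPrefix : Path → Path → Path
commonPrefix [] _ = []
commonPrefix (_ ∷ _) [] = []
commonPrefix (d ∷ x) (e ∷ y) with d ≟D e
... | yes _ = d ∷ commonPrefix x y
... | no _ = []

commonPrefix-≼ˡ : ∀ x y → commonPrefix x y ≼ x
commonPrefix-≼ˡ [] _ = [] , refl
commonPrefix-≼ˡ (d ∷ x) [] = d ∷ x , refl
commonPrefix-≼ˡ (d ∷ x) (e ∷ y) with d ≟D e
... | yes _ = ≼-∷ (commonPrefix-≼ˡ x y)
... | no _ = d ∷ x , refl

commonPrefix-≼ʳ : ∀ x y → commonPrefix x y ≼ y
commonPrefix-≼ʳ [] y = y , refl
commonPrefix-≼ʳ (d ∷ x) [] = [] , refl
commonPrefix-≼ʳ (d ∷ x) (e ∷ y) with d ≟D e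
... | yes refl = ≼-∷ (commonPrefix-≼ʳ x y)
... | no _ = e ∷ y , refl

commonPrefix-greatest : ∀ z {x y} → z ≼ x → z ≼ y → z ≼ commonPrefix x y
commonPrefix-greatest [] _ _ = _ , refl
commonPrefix-greatest (d ∷ z) (s , refl) (s′ , refl) with d ≟D d
... | yes _ = ≼-∷ (commonPrefix-greatest z (s , refl) (s′ , refl))
... | no d≢d = ⊥-elim (d≢d refl)

isNode-prefix : ∀ {t x y} → x ≼ y → IsNode t y → IsNode t x
isNode-prefix {x = []} _ here = here
isNode-prefix {x = []} _ (goL _) = here
isNode-prefix {x = []} _ (goR _) = here
isNode-prefix {x = L ∷ x} (s , refl) (goL h) = goL (isNode-prefix (s , refl) h)
isNode-prefix {x = R ∷ x} (s , refl) (goR h) = goR (isNode-prefix (s , refl) h)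

subtree-node : ∀ {t q} → IsNode t q → subtree t q ≡ node (subtree t (q ++ [ L ])) (subtree t (q ++ [ R ]))
subtree-node here = refl
subtree-node (goL h) = subtree-node h
subtree-node (goR h) = subtree-node h

subtree-isNode : ∀ {t q l r} → subtree t q ≡ node l r → IsNode t q
subtree-isNode {node _ _} {[]} _ = here
subtree-isNode {node l _} {L ∷ q} e = goL (subtree-isNode {l} {q} e)
subtree-isNode {node _ r} {R ∷ q} e = goR (subtree-isNode {r} {q} e)

subtree-++ : ∀ t q w → subtree t (q ++ w) ≡ subtree (subtree t q) w
subtree-++ t [] w = refl
subtree-++ leaf (_ ∷ _) [] = refl
subtree-++ leaf (_ ∷ _) (_ ∷ _) = refl
subtree-++ (node l _) (L ∷ q) w = subtree-++ l q w
subtree-++ (node _ r) (R ∷ q) w = subtree-++ r q w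

subtree-child : ∀ t q {s} d → subtree t q ≡ s → subtree t (q ++ [ d ]) ≡ subtree s [ d ]
subtree-child t q d e = trans (subtree-++ t q [ d ]) (cong (λ s → subtree s [ d ]) e)

size : Tree → ℕ
size leaf = 0
size (node l r) = suc (size l + size r)

data Every (P : Path → Set) : Path → Tree → Set where
  leaf : ∀ {q} → Every P q leaf
  node : ∀ {q l r} → P q → Every P (q ++ [ L ]) l → Every P (q ++ [ R ]) r → Every P q (node l r)

Every-map : ∀ {P Q : Path → Set} → (∀ {x} → P x → Q x) → ∀ {q s} → Every P q s → Every Q q s
Every-map f leaf = leaf
Every-map f (node p el er) = node (f p) (Every-map f el) (Every-map f er)

bpAt : Path → Tree → List (Paren × Path)
bpAt q leaf = []
bpAt q (node l r) = (op , q) ∷ bpAt (q ++ [ L ]) l ++ (cl , q) ∷ bpAt (q ++ [ R ]) r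

bpAt-∷ : ∀ d q s → bpAt (d ∷ q) s ≡ map (tag d) (bpAt q s)
bpAt-∷ d q leaf = refl
bpAt-∷ d q (node l r) = cong ((op , d ∷ q) ∷_) (begin
    bpAt (d ∷ q ++ [ L ]) l ++ (cl , d ∷ q) ∷ bpAt (d ∷ q ++ [ R ]) r
  ≡⟨ cong₂ (λ xs ys → xs ++ (cl , d ∷ q) ∷ ys) (bpAt-∷ d (q ++ [ L ]) l) (bpAt-∷ d (q ++ [ R ]) r) ⟩
    map (tag d) (bpAt (q ++ [ L ]) l) ++ map (tag d) ((cl , q) ∷ bpAt (q ++ [ R ]) r)
  ≡⟨ sym (map-++ (tag d) (bpAt (q ++ [ L ]) l) _) ⟩
    map (tag d) (bpAt (q ++ [ L ]) l ++ (cl , q) ∷ bpAt (q ++ [ R ]) r) ∎)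

bp≡bpAt : ∀ t → bp t ≡ bpAt [] t
bp≡bpAt leaf = refl
bp≡bpAt (node l r) = cong₂ (λ xs ys → (op , []) ∷ xs ++ (cl , []) ∷ ys)
  (trans (cong (map (tag L)) (bp≡bpAt l)) (sym (bpAt-∷ L [] l)))
  (trans (cong (map (tag R)) (bp≡bpAt r)) (sym (bpAt-∷ R [] r)))

bpAt-Every : ∀ {P q s} → Every P q s → All (P ∘ proj₂) (bpAt q s)
bpAt-Every leaf = []
bpAt-Every (node p el er) = p ∷ ++⁺ (bpAt-Every el) (p ∷ bpAt-Every er)

bpAt-nodes : ∀ {t} q s → subtree t q ≡ s → All (λ e → IsNode t (proj₂ e) × q ≼ proj₂ e) (bpAt q s)
bpAt-nodes q leaf _ = []
bpAt-nodes {t} q (node l r) e =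
  root ∷ ++⁺ (All.map (below L) (bpAt-nodes (q ++ [ L ]) l (subtree-child t q L e)))
             (root ∷ All.map (below R) (bpAt-nodes (q ++ [ R ]) r (subtree-child t q R e)))
  where
    root = subtree-isNode e , ≼-refl
    below : ∀ {t x} d → IsNode t x × (q ++ [ d ]) ≼ x → IsNode t x × q ≼ x
    below d (n , le) = n , ≼-trans ([ d ] , refl) le

closes : List (Paren × Path) → ℕ
closes xs = length (filter (λ e → isClose (proj₁ e) Bool.≟ true) xs)

closes-++ : ∀ xs ys → closes (xs ++ ys) ≡ closes xs + closes ys
closes-++ xs ys = trans (cong length (filter-++ _ xs ys)) (length-++ (filter _ xs))

closes-bpAt : ∀ q s → closes (bpAt q s) ≡ size s
closes-bpAt q leaf = refl
closes-bpAt q (node l r) = begin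
    closes (bpAt (q ++ [ L ]) l ++ (cl , q) ∷ bpAt (q ++ [ R ]) r)
  ≡⟨ closes-++ (bpAt (q ++ [ L ]) l) _ ⟩
    closes (bpAt (q ++ [ L ]) l) + suc (closes (bpAt (q ++ [ R ]) r))
  ≡⟨ cong₂ (λ a b → a + suc b) (closes-bpAt (q ++ [ L ]) l) (closes-bpAt (q ++ [ R ]) r) ⟩
    size l + suc (size r)
  ≡⟨ +-suc (size l) (size r) ⟩
    size (node l r) ∎

inorder-in : ∀ {S q} l r → S q ≡ true →
  inorderInduced S q (node l r) ≡ inorderInduced S (q ++ [ L ]) l ++ q ∷ inorderInduced S (q ++ [ R ]) r
inorder-in l r e rewrite e = refl

inorder-out : ∀ {S q} s → S q ≡ false → inorderInduced S q s ≡ []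
inorder-out leaf _ = refl
inorder-out (node l r) e rewrite e = refl

inorder-below : ∀ S q s → All (q ≼_) (inorderInduced S q s)
inorder-below S q leaf = []
inorder-below S q (node l r) with S q
... | false = []
... | true = ++⁺ (All.map (≼-trans ([ L ] , refl)) (inorder-below S (q ++ [ L ]) l))
                 (≼-refl ∷ All.map (≼-trans ([ R ] , refl)) (inorder-below S (q ++ [ R ]) r))

length-inorder : ∀ {S q s} → Every (λ x → S x ≡ true) q s → length (inorderInduced S q s) ≡ size s
length-inorder leaf = refl
length-inorder {S} {q} (node {l = l} {r} Sq el er) rewrite Sq = begin
    length (inorderInduced S (q ++ [ L ]) l ++ q ∷ inorderInduced S (q ++ [ R ]) r)
  ≡⟨ length-++ (inorderInduced S (q ++ [ L ]) l) ⟩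
    length (inorderInduced S (q ++ [ L ]) l) + suc (length (inorderInduced S (q ++ [ R ]) r))
  ≡⟨ cong₂ (λ a b → a + suc b) (length-inorder el) (length-inorder er) ⟩
    size l + suc (size r)
  ≡⟨ +-suc (size l) (size r) ⟩
    size (node l r) ∎

bpBelow : Tree → Path → List (Paren × Path)
bpBelow t q = bpAt q (subtree t q)

inorderBelow : Tree → (Path → Bool) → Path → List Path
inorderBelow t S q = inorderInduced S q (subtree t q)

bpBelow-node : ∀ {t q} → IsNode t q → ∀ zs →
  bpBelow t q ++ zs ≡ (op , q) ∷ bpBelow t (q ++ [ L ]) ++ (cl , q) ∷ bpBelow t (q ++ [ R ]) ++ zs
bpBelow-node {t} {q} h zs = begin
    bpAt q (subtree t q) ++ zs
  ≡⟨ cong (λ s → bpAt q s ++ zs) (subtree-node h) ⟩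
    (op , q) ∷ (bpBelow t (q ++ [ L ]) ++ (cl , q) ∷ bpBelow t (q ++ [ R ])) ++ zs
  ≡⟨ cong ((op , q) ∷_) (++-assoc (bpBelow t (q ++ [ L ])) _ zs) ⟩
    (op , q) ∷ bpBelow t (q ++ [ L ]) ++ (cl , q) ∷ bpBelow t (q ++ [ R ]) ++ zs ∎

inorderBelow-node : ∀ {t S q} → IsNode t q → S q ≡ true → ∀ ys →
  inorderBelow t S q ++ ys ≡ inorderBelow t S (q ++ [ L ]) ++ q ∷ inorderBelow t S (q ++ [ R ]) ++ ys
inorderBelow-node {t} {S} {q} h Sq ys = begin
    inorderInduced S q (subtree t q) ++ ys
  ≡⟨ cong (λ s → inorderInduced S q s ++ ys) (subtree-node h) ⟩
    inorderInduced S q (node (subtree t (q ++ [ L ])) (subtree t (q ++ [ R ]))) ++ ys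
  ≡⟨ cong (_++ ys) (inorder-in (subtree t (q ++ [ L ])) (subtree t (q ++ [ R ])) Sq) ⟩
    (inorderBelow t S (q ++ [ L ]) ++ q ∷ inorderBelow t S (q ++ [ R ])) ++ ys
  ≡⟨ ++-assoc (inorderBelow t S (q ++ [ L ])) _ ys ⟩
    inorderBelow t S (q ++ [ L ]) ++ q ∷ inorderBelow t S (q ++ [ R ]) ++ ys ∎

inorderBelow-outside : ∀ {t S q} → (IsNode t q → S q ≡ false) → inorderBelow t S q ≡ []
inorderBelow-outside {t} {S} {q} out with subtree t q in e
... | leaf = refl
... | node l r = inorder-out (node l r) (out (subtree-isNode e))

==P-refl : ∀ p → (p ==P p) ≡ true
==P-refl p = trans (isYes≗does (≡-dec _≟D_ p p)) (dec-true (≡-dec _≟D_ p p) refl)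

==P-≢ : ∀ {p q} → p ≢ q → (p ==P q) ≡ false
==P-≢ {p} {q} p≢q = trans (isYes≗does (≡-dec _≟D_ p q)) (dec-false (≡-dec _≟D_ p q) p≢q)

indexOf-here : ∀ x ys → indexOf x (x ∷ ys) ≡ 0
indexOf-here x ys rewrite ==P-refl x = refl

indexOf-++ : ∀ {x} xs ys → All (x ≢_) xs → indexOf x (xs ++ ys) ≡ length xs + indexOf x ys
indexOf-++ [] ys [] = refl
indexOf-++ {x} (y ∷ xs) ys (x≢y ∷ x∉xs) rewrite ==P-≢ x≢y = cong suc (indexOf-++ xs ys x∉xs)

module _ {a p} {A : Set a} {P : Pred A p} (P? : Decidable P) where

  takeWhile-++ : ∀ {xs} ys → All P xs → takeWhile P? (xs ++ ys) ≡ xs ++ takeWhile P? ys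
  takeWhile-++ ys [] = refl
  takeWhile-++ {x ∷ _} ys (px ∷ pxs) with P? x
  ... | yes _ = cong (x ∷_) (takeWhile-++ ys pxs)
  ... | no ¬px = ⊥-elim (¬px px)

  dropWhile-++ : ∀ {xs} ys → All P xs → dropWhile P? (xs ++ ys) ≡ dropWhile P? ys
  dropWhile-++ ys [] = refl
  dropWhile-++ {x ∷ _} ys (px ∷ pxs) with P? x
  ... | yes _ = dropWhile-++ ys pxs
  ... | no ¬px = ⊥-elim (¬px px)

  takeWhile-stop : ∀ {x} xs → ¬ P x → takeWhile P? (x ∷ xs) ≡ []
  takeWhile-stop {x} xs ¬px with P? x
  ... | yes px = ⊥-elim (¬px px)
  ... | no _ = refl

  dropWhile-stop : ∀ {x} xs → ¬ P x → dropWhile P? (x ∷ xs) ≡ x ∷ xs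
  dropWhile-stop {x} xs ¬px with P? x
  ... | yes px = ⊥-elim (¬px px)
  ... | no _ = refl

module MicroTree {t : Tree} {m : Path → ℕ} (FM : FMPartition t m) {k : ℕ} {r : Path}
                 (root : IsRootOf t m k r) where

  open FMPartition FM

  μ : Path → Set
  μ = InMicro t m k

  r∈μ : μ r
  r∈μ = proj₁ root

  inμ? : Decidable {A = Paren × Path} (λ e → m (proj₂ e) ≡ k)
  inμ? e = m (proj₂ e) ≟ k

  ∉μ? : Decidable {A = Paren × Path} (λ e → m (proj₂ e) ≢ k)
  ∉μ? = ¬? ∘ inμ?

  μ∪ : Path → Path → Bool
  μ∪ x y = (m y ≡ᵇ k) ∨ (y ==P x)

  μ∪-μ : ∀ {x y} → m y ≡ k → μ∪ x y ≡ true
  μ∪-μ {x} {y} e = cong (_∨ (y ==P x)) (dec-true (m y ≟ k) e)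

  μ∪-self : ∀ x → μ∪ x x ≡ true
  μ∪-self x = trans (cong ((m x ≡ᵇ k) ∨_) (==P-refl x)) (∨-zeroʳ _)

  μ∪-out : ∀ {x y} → m y ≢ k → y ≢ x → μ∪ x y ≡ false
  μ∪-out {x} {y} y∉μ y≢x = cong₂ _∨_ (dec-false (m y ≟ k) y∉μ) (==P-≢ y≢x)

  between : ∀ {w x u} → μ w → μ u → w ≼ x → x ≼ u → μ x
  between {w} {x} {u} w∈μ u∈μ w≼x x≼u =
    connected k u w x u∈μ w∈μ x≼u (λ _ _ y≼w → ≼-trans y≼w w≼x)

  strict-ancestor-of-root-∉μ : ∀ {q d w} → q ++ d ∷ w ≡ r → ¬ μ q
  strict-ancestor-of-root-∉μ {q} {d} {w} q<r q∈μ =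
    let p , e , q<p , q≼p = parent-of-descendant q d w
        r≡pe = trans (sym q<r) q<p
    in proj₂ root p e r≡pe (proj₂ (between q∈μ r∈μ q≼p ([ e ] , sym r≡pe)))

  -- The common ancestor of x and r lies in μ by connectivity, hence cannot be strictly above r.
  μ-below-root : ∀ {x} → μ x → r ≼ x
  μ-below-root {x} x∈μ with commonPrefix-≼ʳ x r
  ... | [] , z≡r = subst (_≼ x) (trans (sym (++-identityʳ z)) z≡r) (commonPrefix-≼ˡ x r)
    where z = commonPrefix x r
  ... | _ ∷ _ , z<r = ⊥-elim (strict-ancestor-of-root-∉μ z<r z∈μ)
    where
      z∈μ : μ (commonPrefix x r)
      z∈μ = connected k x r (commonPrefix x r) x∈μ r∈μ (commonPrefix-≼ˡ x r)
              (λ y y≼x y≼r → commonPrefix-greatest y y≼x y≼r)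

  ancestor-of-root-unlabelled : ∀ {q d w} → q ++ d ∷ w ≡ r → m q ≢ k
  ancestor-of-root-unlabelled {q} {d} {w} q<r q∈k =
    strict-ancestor-of-root-∉μ q<r (isNode-prefix (d ∷ w , q<r) (proj₁ r∈μ) , q∈k)

  dropWhile-into-child : ∀ {q} d {w} → q ++ d ∷ w ≡ r → ∀ zs →
    ∃[ zs′ ] dropWhile ∉μ? (bpBelow t q ++ zs) ≡ dropWhile ∉μ? (bpBelow t (q ++ [ d ]) ++ zs′)
  dropWhile-into-child {q} L q<r zs =
    _ , trans (cong (dropWhile ∉μ?) (bpBelow-node (isNode-prefix (_ , q<r) (proj₁ r∈μ)) zs))
              (dropWhile-++ ∉μ? _ (ancestor-of-root-unlabelled q<r ∷ []))
  dropWhile-into-child {q} R {w} q<r zs = zs , (begin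
      dropWhile ∉μ? (bpBelow t q ++ zs)
    ≡⟨ cong (dropWhile ∉μ?) (bpBelow-node (isNode-prefix (_ , q<r) (proj₁ r∈μ)) zs) ⟩
      dropWhile ∉μ? ((op , q) ∷ bpBelow t (q ++ [ L ]) ++ (cl , q) ∷ bpBelow t (q ++ [ R ]) ++ zs)
    ≡⟨ dropWhile-++ ∉μ? _ (q∉μ ∷ All.map left∉μ (bpAt-nodes (q ++ [ L ]) _ refl)) ⟩
      dropWhile ∉μ? ((cl , q) ∷ bpBelow t (q ++ [ R ]) ++ zs)
    ≡⟨ dropWhile-++ ∉μ? _ (q∉μ ∷ []) ⟩
      dropWhile ∉μ? (bpBelow t (q ++ [ R ]) ++ zs) ∎)
    where
      q∉μ = ancestor-of-root-unlabelled q<r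
      left∉μ : ∀ {x} → IsNode t x × (q ++ [ L ]) ≼ x → m x ≢ k
      left∉μ (x-node , qL≼x) x∈k =
        ≼-left⇒¬≼-right qL≼x (≼-trans (w , trans (++-assoc q [ R ] w) q<r) (μ-below-root (x-node , x∈k)))

  dropWhile-to-root : ∀ q w → q ++ w ≡ r → ∀ zs →
    ∃[ rest ] dropWhile ∉μ? (bpBelow t q ++ zs) ≡ bpBelow t r ++ rest
  dropWhile-to-root q [] q≡r zs with refl ← trans (sym (++-identityʳ q)) q≡r =
    zs , trans (cong (dropWhile ∉μ?) (bpBelow-node (proj₁ r∈μ) zs))
               (trans (dropWhile-stop ∉μ? _ (λ r∉μ → r∉μ (proj₂ r∈μ))) (sym (bpBelow-node (proj₁ r∈μ) zs)))
  dropWhile-to-root q (d ∷ w) q<r zs =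
    let zs′ , into = dropWhile-into-child d q<r zs
        rest , skip = dropWhile-to-root (q ++ [ d ]) w (trans (++-assoc q [ d ] w) q<r) zs′
    in rest , trans into skip

  leftChunk-from-root : ∃[ rest ] leftChunk t m k ≡ takeWhile inμ? (bpBelow t r ++ rest)
  leftChunk-from-root =
    let rest , skip = dropWhile-to-root [] r refl [] in
    rest , cong (takeWhile inμ?)
                (trans (cong (dropWhile ∉μ?) (trans (bp≡bpAt t) (sym (++-identityʳ _)))) skip)

  childRoot-isNode : ∀ {x} → IsChildRoot t m k x → IsNode t x
  childRoot-isNode ((_ , (x-node , _) , _) , _) = x-node

  childRoot-∉μ : ∀ {x} → IsChildRoot t m k x → m x ≢ k
  childRoot-∉μ ((j , (_ , x∈j) , parent∉j) , p , d , x≡pd , p∈μ) x∈k =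
    parent∉j p d x≡pd (trans (proj₂ p∈μ) (trans (sym x∈k) x∈j))

  childRoot-descendant-∉μ : ∀ {x y} → IsChildRoot t m k x → x ≼ y → ¬ μ y
  childRoot-descendant-∉μ cr@(_ , p , d , x≡pd , p∈μ) x≼y y∈μ =
    childRoot-∉μ cr (proj₂ (between p∈μ y∈μ ([ d ] , sym x≡pd) x≼y))

  childRoot-intro : ∀ {q d} → μ q → IsNode t (q ++ [ d ]) → m (q ++ [ d ]) ≢ k →
    IsChildRoot t m k (q ++ [ d ])
  childRoot-intro {q} {d} q∈μ qd-node qd∉μ =
    (m (q ++ [ d ]) , (qd-node , refl) , parent∉) , q , d , refl , q∈μ
    where
      parent∉ : ∀ p e → q ++ [ d ] ≡ p ++ [ e ] → m p ≢ m (q ++ [ d ])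
      parent∉ p e qd≡pe mp≡ =
        qd∉μ (trans (sym mp≡) (trans (cong m (sym (∷ʳ-injectiveˡ q p qd≡pe))) (proj₂ q∈μ)))

  full-or-childRoot : ∀ {q} d {s} → μ q → subtree t (q ++ [ d ]) ≡ s →
    Every (λ x → m x ≡ k) (q ++ [ d ]) s ⊎ ∃[ c′ ] (IsChildRoot t m k c′ × (q ++ [ d ]) ≼ c′)
  full-or-childRoot d {leaf} _ _ = inj₁ leaf
  full-or-childRoot {q} d {node _ _} q∈μ e with m (q ++ [ d ]) ≟ k
  ... | no qd∉μ = inj₂ (_ , childRoot-intro q∈μ (subtree-isNode e) qd∉μ , ≼-refl)
  ... | yes qd∈k with full-or-childRoot L (subtree-isNode e , qd∈k) (subtree-child t (q ++ [ d ]) L e)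
                    | full-or-childRoot R (subtree-isNode e , qd∈k) (subtree-child t (q ++ [ d ]) R e)
  ...   | inj₁ left | inj₁ right = inj₁ (node qd∈k left right)
  ...   | inj₂ (c′ , cr , le) | _ = inj₂ (c′ , cr , ≼-trans ([ L ] , refl) le)
  ...   | inj₁ _ | inj₂ (c′ , cr , le) = inj₂ (c′ , cr , ≼-trans ([ R ] , refl) le)

  indexOf-childRoot : ∀ {x} → IsChildRoot t m k x → ∀ ys →
    indexOf x (inorderBelow t (μ∪ x) x ++ ys) ≡ 0
  indexOf-childRoot {x} cr ys = begin
      indexOf x (inorderBelow t (μ∪ x) x ++ ys)
    ≡⟨ cong (indexOf x) (inorderBelow-node (childRoot-isNode cr) (μ∪-self x) ys) ⟩
      indexOf x (inorderBelow t (μ∪ x) (x ++ [ L ]) ++ x ∷ inorderBelow t (μ∪ x) (x ++ [ R ]) ++ ys)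
    ≡⟨ cong (λ xs → indexOf x (xs ++ x ∷ inorderBelow t (μ∪ x) (x ++ [ R ]) ++ ys))
            (inorderBelow-outside xL∉) ⟩
      indexOf x (x ∷ inorderBelow t (μ∪ x) (x ++ [ R ]) ++ ys)
    ≡⟨ indexOf-here x (inorderBelow t (μ∪ x) (x ++ [ R ]) ++ ys) ⟩
      0 ∎
    where
      xL∉ : IsNode t (x ++ [ L ]) → μ∪ x (x ++ [ L ]) ≡ false
      xL∉ n = μ∪-out (λ e → childRoot-descendant-∉μ cr ([ L ] , refl) (n , e)) (xs++y∷ys≢xs x)

  portalRank-at-root : ∀ x → portalRank t m k r x
    ≡ suc (indexOf x (inorderBelow t (μ∪ x) (r ++ [ L ]) ++ r ∷ inorderBelow t (μ∪ x) (r ++ [ R ]) ++ []))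
  portalRank-at-root x = cong (suc ∘ indexOf x)
    (trans (sym (++-identityʳ _)) (inorderBelow-node (proj₁ r∈μ) (μ∪-μ (proj₂ r∈μ)) []))

  portalRank-leftChild : IsChildRoot t m k (r ++ [ L ]) → portalRank t m k r (r ++ [ L ]) ≡ 1
  portalRank-leftChild cr = trans (portalRank-at-root (r ++ [ L ])) (cong suc (indexOf-childRoot cr _))

  1<portalRank : ∀ {x} → (r ++ [ R ]) ≼ x → ¬ μ (r ++ [ L ]) → 1 < portalRank t m k r x
  1<portalRank {x} rR≼x rL∉μ =
    subst (1 <_) (sym (trans (portalRank-at-root x) (cong suc index≡))) (s≤s (s≤s z≤n))
    where
      rL∉ : IsNode t (r ++ [ L ]) → μ∪ x (r ++ [ L ]) ≡ false
      rL∉ n = μ∪-out (λ e → rL∉μ (n , e))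
                (λ rL≡x → ≼-left⇒¬≼-right (subst ((r ++ [ L ]) ≼_) rL≡x ≼-refl) rR≼x)
      index≡ : indexOf x (inorderBelow t (μ∪ x) (r ++ [ L ]) ++ r ∷ inorderBelow t (μ∪ x) (r ++ [ R ]) ++ [])
               ≡ suc (indexOf x (inorderBelow t (μ∪ x) (r ++ [ R ]) ++ []))
      index≡ = trans (cong (λ xs → indexOf x (xs ++ r ∷ inorderBelow t (μ∪ x) (r ++ [ R ]) ++ []))
                            (inorderBelow-outside rL∉))
                     (indexOf-++ [ r ] (inorderBelow t (μ∪ x) (r ++ [ R ]) ++ []) (≼-child⇒≢ rR≼x ∷ []))

  closes-past-full-left : ∀ {q} → μ q → Every (λ x → m x ≡ k) (q ++ [ L ]) (subtree t (q ++ [ L ])) →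
    ∀ rest →
    closes (takeWhile inμ? (bpBelow t q ++ rest))
      ≡ size (subtree t (q ++ [ L ])) + suc (closes (takeWhile inμ? (bpBelow t (q ++ [ R ]) ++ rest)))
  closes-past-full-left {q} (q-node , q∈k) full rest = begin
      closes (takeWhile inμ? (bpBelow t q ++ rest))
    ≡⟨ cong (closes ∘ takeWhile inμ?) (bpBelow-node q-node rest) ⟩
      closes (takeWhile inμ? ((op , q) ∷ left ++ (cl , q) ∷ right ++ rest))
    ≡⟨ cong closes (takeWhile-++ inμ? _ (q∈k ∷ bpAt-Every full)) ⟩
      closes (left ++ takeWhile inμ? ((cl , q) ∷ right ++ rest))
    ≡⟨ cong (λ xs → closes (left ++ xs)) (takeWhile-++ inμ? _ (q∈k ∷ [])) ⟩
      closes (left ++ (cl , q) ∷ takeWhile inμ? (right ++ rest))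
    ≡⟨ closes-++ left _ ⟩
      closes left + suc (closes (takeWhile inμ? (right ++ rest)))
    ≡⟨ cong (λ n → n + suc (closes (takeWhile inμ? (right ++ rest)))) (closes-bpAt (q ++ [ L ]) _) ⟩
      size (subtree t (q ++ [ L ])) + suc (closes (takeWhile inμ? (right ++ rest))) ∎
    where
      left = bpBelow t (q ++ [ L ])
      right = bpBelow t (q ++ [ R ])

  indexOf-past-full-left : ∀ {q x} → μ q → Every (λ y → m y ≡ k) (q ++ [ L ]) (subtree t (q ++ [ L ])) →
    (q ++ [ R ]) ≼ x → ∀ ys →
    indexOf x (inorderBelow t (μ∪ x) q ++ ys)
      ≡ size (subtree t (q ++ [ L ])) + suc (indexOf x (inorderBelow t (μ∪ x) (q ++ [ R ]) ++ ys))
  indexOf-past-full-left {q} {x} (q-node , q∈k) full qR≼x ys = begin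
      indexOf x (inorderBelow t (μ∪ x) q ++ ys)
    ≡⟨ cong (indexOf x) (inorderBelow-node q-node (μ∪-μ q∈k) ys) ⟩
      indexOf x (left ++ q ∷ right ++ ys)
    ≡⟨ indexOf-++ left (q ∷ right ++ ys) x∉left ⟩
      length left + indexOf x (q ∷ right ++ ys)
    ≡⟨ cong₂ _+_ (length-inorder (Every-map μ∪-μ full))
                 (indexOf-++ [ q ] (right ++ ys) (≼-child⇒≢ qR≼x ∷ [])) ⟩
      size (subtree t (q ++ [ L ])) + suc (indexOf x (right ++ ys)) ∎
    where
      left = inorderBelow t (μ∪ x) (q ++ [ L ])
      right = inorderBelow t (μ∪ x) (q ++ [ R ])
      x∉left : All (x ≢_) left
      x∉left = All.map (λ qL≼y x≡y → ≼-left⇒¬≼-right (subst ((q ++ [ L ]) ≼_) (sym x≡y) qL≼y) qR≼x)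
                       (inorder-below (μ∪ x) (q ++ [ L ]) (subtree t (q ++ [ L ])))

module LeftmostChildRoot {t : Tree} {m : Path → ℕ} (FM : FMPartition t m) {k : ℕ} {r : Path}
  (root : IsRootOf t m k r) {c : Path} (c-root : IsChildRoot t m k c)
  (leftmost : ∀ c′ → IsChildRoot t m k c′ → portalRank t m k r c ≤ portalRank t m k r c′) where

  open FMPartition FM
  open MicroTree FM root

  r≼c : r ≼ c
  r≼c = let _ , d , c≡pd , p∈μ = proj₂ c-root in ≼-trans (μ-below-root p∈μ) ([ d ] , sym c≡pd)

  strict-ancestor-of-c-∈μ : ∀ {q d w} → r ≼ q → q ++ d ∷ w ≡ c → μ q
  strict-ancestor-of-c-∈μ {q} {d} {w} r≼q q<c =
    let p , _ , c≡pd , p∈μ = proj₂ c-root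
        p′ , _ , q<p′e , q≼p′ = parent-of-descendant q d w
        p′≡p = ∷ʳ-injectiveˡ p′ p (trans (sym q<p′e) (trans q<c c≡pd))
    in between r∈μ p∈μ r≼q (subst (q ≼_) p′≡p q≼p′)

  no-left-child-if-μ-singleton : (∀ {x} → μ x → x ≡ r) → (r ++ [ R ]) ≼ c → ¬ IsNode t (r ++ [ L ])
  no-left-child-if-μ-singleton singleton rR≼c rL-node =
    <⇒≱ (1<portalRank rR≼c rL∉μ) (≤-trans (leftmost _ rL-root) (≤-reflexive (portalRank-leftChild rL-root)))
    where
      rL∉μ : ¬ μ (r ++ [ L ])
      rL∉μ rL∈μ = xs++y∷ys≢xs r (singleton rL∈μ)
      rL-root = childRoot-intro r∈μ rL-node (λ e → rL∉μ (rL-node , e))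

  -- Such a c′ differs from c, so twoChildrenSingle makes μ the single node q = r; then the left
  -- child of r is itself a child root, of portal rank 1 < portal rank of c.
  childRoot-not-left-of-path : ∀ {q c′} → μ q → (q ++ [ R ]) ≼ c → IsChildRoot t m k c′ →
    ¬ ((q ++ [ L ]) ≼ c′)
  childRoot-not-left-of-path {q} {c′} q∈μ qR≼c c′-root qL≼c′ =
    no-left-child-if-μ-singleton singleton (subst (λ p → (p ++ [ R ]) ≼ c) q≡r qR≼c)
      (subst (λ p → IsNode t (p ++ [ L ])) q≡r (isNode-prefix qL≼c′ (childRoot-isNode c′-root)))
    where
      singleton : ∀ {x} → μ x → x ≡ r
      singleton x∈μ =
        twoChildrenSingle k c c′ c-root c′-root (λ { refl → ≼-left⇒¬≼-right qL≼c′ qR≼c }) _ r x∈μ r∈μ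
      q≡r = singleton q∈μ

  left-of-path-full : ∀ {q} → μ q → (q ++ [ R ]) ≼ c →
    Every (λ x → m x ≡ k) (q ++ [ L ]) (subtree t (q ++ [ L ]))
  left-of-path-full q∈μ qR≼c with full-or-childRoot L q∈μ refl
  ... | inj₁ full = full
  ... | inj₂ (_ , c′-root , qL≼c′) = ⊥-elim (childRoot-not-left-of-path q∈μ qR≼c c′-root qL≼c′)

  ClosesMatchIndex : Path → Set
  ClosesMatchIndex q = ∀ rest ys →
    closes (takeWhile inμ? (bpBelow t q ++ rest)) ≡ indexOf c (inorderBelow t (μ∪ c) q ++ ys)

  closes-match-index-at-c : ClosesMatchIndex c
  closes-match-index-at-c rest ys = begin
      closes (takeWhile inμ? (bpBelow t c ++ rest))
    ≡⟨ cong (closes ∘ takeWhile inμ?) (bpBelow-node (childRoot-isNode c-root) rest) ⟩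
      closes (takeWhile inμ? ((op , c) ∷ bpBelow t (c ++ [ L ]) ++ (cl , c) ∷ bpBelow t (c ++ [ R ]) ++ rest))
    ≡⟨ cong closes (takeWhile-stop inμ? _ (childRoot-∉μ c-root)) ⟩
      0
    ≡⟨ sym (indexOf-childRoot c-root ys) ⟩
      indexOf c (inorderBelow t (μ∪ c) c ++ ys) ∎

  closes-match-index-left : ∀ {q} → μ q → ClosesMatchIndex (q ++ [ L ]) → ClosesMatchIndex q
  closes-match-index-left {q} (q-node , q∈k) match rest ys = begin
      closes (takeWhile inμ? (bpBelow t q ++ rest))
    ≡⟨ cong (closes ∘ takeWhile inμ?) (bpBelow-node q-node rest) ⟩
      closes (takeWhile inμ? ((op , q) ∷ bpBelow t (q ++ [ L ]) ++ (cl , q) ∷ bpBelow t (q ++ [ R ]) ++ rest))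
    ≡⟨ cong closes (takeWhile-++ inμ? _ (q∈k ∷ [])) ⟩
      closes (takeWhile inμ? (bpBelow t (q ++ [ L ]) ++ (cl , q) ∷ bpBelow t (q ++ [ R ]) ++ rest))
    ≡⟨ match _ _ ⟩
      indexOf c (inorderBelow t (μ∪ c) (q ++ [ L ]) ++ q ∷ inorderBelow t (μ∪ c) (q ++ [ R ]) ++ ys)
    ≡⟨ cong (indexOf c) (sym (inorderBelow-node q-node (μ∪-μ q∈k) ys)) ⟩
      indexOf c (inorderBelow t (μ∪ c) q ++ ys) ∎

  closes-match-index-right : ∀ {q} → μ q → (q ++ [ R ]) ≼ c →
    ClosesMatchIndex (q ++ [ R ]) → ClosesMatchIndex q
  closes-match-index-right {q} q∈μ qR≼c match rest ys = begin
      closes (takeWhile inμ? (bpBelow t q ++ rest))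
    ≡⟨ closes-past-full-left q∈μ full rest ⟩
      size (subtree t (q ++ [ L ])) + suc (closes (takeWhile inμ? (bpBelow t (q ++ [ R ]) ++ rest)))
    ≡⟨ cong (λ n → size (subtree t (q ++ [ L ])) + suc n) (match rest ys) ⟩
      size (subtree t (q ++ [ L ])) + suc (indexOf c (inorderBelow t (μ∪ c) (q ++ [ R ]) ++ ys))
    ≡⟨ sym (indexOf-past-full-left q∈μ full qR≼c ys) ⟩
      indexOf c (inorderBelow t (μ∪ c) q ++ ys) ∎
    where full = left-of-path-full q∈μ qR≼c

  closes-match-index : ∀ q w → r ≼ q → q ++ w ≡ c → ClosesMatchIndex q
  closes-match-index q [] _ q≡c with refl ← trans (sym (++-identityʳ q)) q≡c = closes-match-index-at-c
  closes-match-index q (L ∷ w) r≼q q<c =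
    closes-match-index-left (strict-ancestor-of-c-∈μ r≼q q<c)
      (closes-match-index (q ++ [ L ]) w (≼-trans r≼q ([ L ] , refl)) (trans (++-assoc q [ L ] w) q<c))
  closes-match-index q (R ∷ w) r≼q q<c =
    closes-match-index-right (strict-ancestor-of-c-∈μ r≼q q<c) (w , qR++w≡c)
      (closes-match-index (q ++ [ R ]) w (≼-trans r≼q ([ R ] , refl)) qR++w≡c)
    where qR++w≡c = trans (++-assoc q [ R ] w) q<c

proposition16 : (t : Tree) (m : Path → ℕ) → FMPartition t m →
    (k : ℕ) (r : Path) → IsRootOf t m k r →
    (c : Path) → IsChildRoot t m k c →
    (∀ c′ → IsChildRoot t m k c′ → portalRank t m k r c ≤ portalRank t m k r c′) →
    splitRank t m k ≡ portalRank t m k r c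
proposition16 t m FM k r root c c-root leftmost =
  let rest , chunk≡ = leftChunk-from-root
      w , r++w≡c = r≼c
  in cong suc (begin
      closes (leftChunk t m k)
    ≡⟨ cong closes chunk≡ ⟩
      closes (takeWhile inμ? (bpBelow t r ++ rest))
    ≡⟨ closes-match-index r w ≼-refl r++w≡c rest [] ⟩
      indexOf c (inorderBelow t (μ∪ c) r ++ [])
    ≡⟨ cong (indexOf c) (++-identityʳ (inorderBelow t (μ∪ c) r)) ⟩
      indexOf c (inorderBelow t (μ∪ c) r) ∎)
  where
    open MicroTree FM root
    open LeftmostChildRoot FM root c-root leftmost
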